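{- Let ${\boldsymbol\nu}$ be a tuple of skew shapes with $l$ boxes and let $\lambda\in\mathbb Z^l$ be defined by $\lambda_i=\chi(D({\boldsymbol\nu}(i))\text{ contains the first box in a row})-\chi(D({\boldsymbol\nu}(i))\text{ contains the last box in a row})$. Then $$\lambda_i=\chi(D({\boldsymbol\nu}(i))\text{ does not contain the last box in a row})-\chi(D({\boldsymbol\nu}(i))\text{ does not contain the first box in a row}),$$ and $$\lambda=-\sum(R_+\setminus R_q)+\sum\big((R_t\setminus R_{qt})\cap R_+^{\prec}\big).$$
   Context: Skew shapes in French convention; content $c(a)=i-j$ for a box $a$ in column $i$, row $j$. For ${\boldsymbol\nu}=(\nu_{(1)},\dots,\nu_{(k)})$ fix $0<\epsilon<1/k$; adjusted content $\tilde c(a)=c(a)+i\epsilon$ for $a\in\nu_{(i)}$. A diagonal is a set of boxes of fixed adjusted content; $D(a)$ is the diagonal containing $a$. Reading order: $\tilde c$ weakly increasing, and within a diagonal southwest to northeast; ${\boldsymbol\nu}(1),\dots,{\boldsymbol\nu}(l)$ are the boxes in reading order. "First/last box in a row" means westmost/eastmost box of a row of some $\nu_{(i)}$; $\chi(P)=1$ if $P$ holds, else $0$. Roots $\alpha_{ij}=\epsilon_i-\epsilon_j\in\mathbb Z^l$, $R_+=\{\alpha_{ij}:i<j\}$, $\sum A=\sum_{\alpha\in A}\alpha$. $R_q=\{\alpha_{ij}\in R_+:\tilde c({\boldsymbol\nu}(i))<\tilde c({\boldsymbol\nu}(j))\}$, $R_t=\{\alpha_{ij}\in R_+:\tilde c({\boldsymbol\nu}(i))+1\le\tilde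 c({\boldsymbol\nu}(j))\}$, $R_{qt}=\{\alpha_{ij}\in R_+:\tilde c({\boldsymbol\nu}(i))+1<\tilde c({\boldsymbol\nu}(j))\}$. Partial order $\preceq$: $a\preceq b$ if $a,b$ lie in the same $\nu_{(i)}$ and $a$ is weakly southwest of $b$ (product order on coordinates); $R_+^{\prec}=\{\alpha_{ij}\in R_+:{\boldsymbol\nu}(i)\prec{\boldsymbol\nu}(j)\}$. -}

module Defs where

open import Data.Nat as ℕ using (ℕ; zero; suc; _∸_)
open import Data.Integer as ℤ using (ℤ; +_; _-_; -_)
open import Data.Fin as Fin using (Fin; toℕ)
open import Data.Bool using (Bool; true; false; _∧_; _∨_; not; if_then_else_)
open import Data.List using (List; []; _∷_; length; map; concatMap; upTo)
open import Data.Bool.ListAction using (any)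
open import Data.Product using (_×_; _,_; ∃)
open import Data.Sum using (_⊎_)
open import Relation.Binary.PropositionalEquality using (_≡_; _≢_)
open import Relation.Nullary using (Dec; does; ¬_)

-- Partitions as lists of row lengths (row 0 is the bottom row in French
-- convention); rows beyond the list have length 0.

at : List ℕ → ℕ → ℕ
at []       _       = 0
at (x ∷ xs) zero    = x
at (x ∷ xs) (suc r) = at xs r

record Skew : Set where
  field
    outer     : List ℕ
    inner     : List ℕ
    outer-dec : ∀ r → at outer (suc r) ℕ.≤ at outer r
    inner-dec : ∀ r → at inner (suc r) ℕ.≤ at inner r
    contained : ∀ r → at inner r ℕ.≤ at outer r
open Skew public

-- Boxes of a k-tuple of skew shapes: (shape index, column, row), 0-indexed.
-- Box (col , row) lies in λ/μ iff μ_row ≤ col < λ_row.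

record Box (k : ℕ) : Set where
  constructor box
  field
    shp : Fin k
    col : ℕ
    row : ℕ
open Box public

InSkew : Skew → ℕ → ℕ → Set
InSkew S c r = (at (inner S) r ℕ.≤ c) × (c ℕ.< at (outer S) r)

InNu : ∀ {k} → (Fin k → Skew) → Box k → Set
InNu ν b = InSkew (ν (shp b)) (col b) (row b)

range : ℕ → ℕ → List ℕ
range a b = map (a ℕ.+_) (upTo (b ∸ a))

cells : Skew → List (ℕ × ℕ)
cells S = concatMap (λ r → map (λ c → (c , r)) (range (at (inner S) r) (at (outer S) r)))
                    (upTo (length (outer S)))

content : ∀ {k} → Box k → ℤ
content b = + col b - + row b

-- Adjusted content with the choice ε = 1/(k+1) (valid: 0 < ε < 1/k),
-- scaled by (k+1):  adj a = (k+1)·c̃(a) = (k+1)·c(a) + i  for a ∈ ν_(i), i = 1..k.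
adj : ∀ {k} → Box k → ℤ
adj {k} b = + suc k ℤ.* content b ℤ.+ + suc (toℕ (shp b))

-- c̃(a) + 1 ≤ c̃(b)  ⇔  adj a + (k+1) ≤ adj b, etc.
shift : ℕ → ℤ
shift k = + suc k

ReadingBefore : ∀ {k} → Box k → Box k → Set
ReadingBefore a b = (adj a ℤ.< adj b) ⊎ ((adj a ≡ adj b) × (row a ℕ.< row b))

χ : Bool → ℤ
χ true  = + 1
χ false = + 0

isFirst : Skew → ℕ × ℕ → Bool
isFirst S (c , r) = does (c ℕ.≟ at (inner S) r)

isLast : Skew → ℕ × ℕ → Bool
isLast S (c , r) = does (suc c ℕ.≟ at (outer S) r)

-- the cell (c , r) of shape ν_(shp a) lies on the diagonal D(a)
-- (same shape and same content, i.e. same adjusted content)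
onDiag : ∀ {k} → Box k → ℕ × ℕ → Bool
onDiag a (c , r) = does (c ℕ.+ row a ℕ.≟ col a ℕ.+ r)

diagHasFirst : ∀ {k} → (Fin k → Skew) → Box k → Bool
diagHasFirst ν a = any (λ p → onDiag a p ∧ isFirst (ν (shp a)) p) (cells (ν (shp a)))

diagHasLast : ∀ {k} → (Fin k → Skew) → Box k → Bool
diagHasLast ν a = any (λ p → onDiag a p ∧ isLast (ν (shp a)) p) (cells (ν (shp a)))

diagHasNoFirst : ∀ {k} → (Fin k → Skew) → Box k → Bool
diagHasNoFirst ν a = not (diagHasFirst ν a)

diagHasNoLast : ∀ {k} → (Fin k → Skew) → Box k → Bool
diagHasNoLast ν a = not (diagHasLast ν a)

-- Sums of sets of roots in ℤ^l.  A set A ⊆ R_+ is given by a Boolean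
-- predicate on pairs (i , j); only pairs with i < j are counted.
-- (Σ A)_m = Σ_{α_ij ∈ A} (δ_{im} − δ_{jm}).

finSum : ∀ {n} → (Fin n → ℤ) → ℤ
finSum {zero}  f = + 0
finSum {suc n} f = f Fin.zero ℤ.+ finSum (λ i → f (Fin.suc i))

δ : ∀ {l} → Fin l → Fin l → ℤ
δ i m = χ (does (i Fin.≟ m))

sumRoots : ∀ {l} → (Fin l → Fin l → Bool) → Fin l → ℤ
sumRoots {l} A m =
  finSum (λ i → finSum (λ j →
    if does (i Fin.<? j) ∧ A i j then δ i m - δ j m else + 0))

inRq : ∀ {k l} → (Fin l → Box k) → Fin l → Fin l → Bool
inRq e i j = does (adj (e i) ℤ.<? adj (e j))

inRt : ∀ {k l} → (Fin l → Box k) → Fin l → Fin l → Bool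
inRt {k} e i j = does (adj (e i) ℤ.+ shift k ℤ.≤? adj (e j))

inRqt : ∀ {k l} → (Fin l → Box k) → Fin l → Fin l → Bool
inRqt {k} e i j = does (adj (e i) ℤ.+ shift k ℤ.<? adj (e j))

precEq : ∀ {k} → Box k → Box k → Bool
precEq a b = does (shp a Fin.≟ shp b) ∧ does (col a ℕ.≤? col b) ∧ does (row a ℕ.≤? row b)

prec : ∀ {k} → Box k → Box k → Bool
prec a b = precEq a b ∧ not (does (col a ℕ.≟ col b) ∧ does (row a ℕ.≟ row b))

inRprec : ∀ {k l} → (Fin l → Box k) → Fin l → Fin l → Bool
inRprec e i j = prec (e i) (e j)

setA : ∀ {k l} → (Fin l → Box k) → Fin l → Fin l → Bool
setA e i j = not (inRq e i j)

setB : ∀ {k l} → (Fin l → Box k) → Fin l → Fin l → Bool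
setB e i j = (inRt e i j ∧ not (inRqt e i j)) ∧ inRprec e i j

lam : ∀ {k l} → (Fin k → Skew) → (Fin l → Box k) → Fin l → ℤ
lam ν e m = χ (diagHasFirst ν (e m)) - χ (diagHasLast ν (e m))

-- e enumerates the boxes of ν in reading order: e(m) = ν(m+1)
IsReadingEnum : ∀ {k l} → (Fin k → Skew) → (Fin l → Box k) → Set
IsReadingEnum {k} {l} ν e =
  (∀ m → InNu ν (e m)) ×
  (∀ b → InNu ν b → ∃ λ m → e m ≡ b) ×
  (∀ m m' → m Fin.< m' → ReadingBefore (e m) (e m'))

-- The first identity is χ b − χ c = χ (not c) − χ (not b) for Booleans b, c.
--
-- For the second, fix a = ν(m) in ν_(s). The m-th coordinate of Σ A is the number of roots α_mj in A
-- minus the number of roots α_im in A. A pair in R_+ ∖ R_q is a pair of boxes on one diagonal, in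
-- reading order; a pair in (R_t ∖ R_qt) ∩ R_+^≺ is a pair b ≺ b′ with b′ on the diagonal after D(b).
-- So the right-hand side at m is a signed count of boxes of ν_(s) on D(a) and on its two neighbouring
-- diagonals, and we regroup it row by row, since a row meets each diagonal in at most one box. In a
-- row y below a only the western end of the row can lie on D(a), above a only the eastern end, and
-- the contribution of row y is χ(its first box lies on D(a)) − χ(its last box lies on D(a)). The
-- boundaries of a skew shape are monotone, so at most one row has its first (last) box on D(a), and
-- summing over the rows gives λ_m.

module Submission where

open import Defs
open import Algebra.Bundles using (AbelianGroup)
open import Data.Nat as ℕ using (ℕ; zero; suc; _∸_)
import Data.Nat.Properties as ℕP
open import Data.Integer as ℤ using (ℤ; +_; _-_; -_; _+_; _*_)
import Data.Integer.Properties as ℤP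
open import Algebra.Properties.Group (AbelianGroup.group ℤP.+-0-abelianGroup) using (∙-cancelˡ)
open import Data.Integer.Tactic.RingSolver using (solve-∀)
open import Data.Fin as Fin using (Fin; toℕ)
import Data.Fin.Properties as FinP
open import Data.Bool using (Bool; true; false; _∧_; not; if_then_else_)
open import Data.Bool.Properties using (∧-identityʳ; T-≡)
open import Data.Bool.ListAction using (any)
open import Data.List using (List; []; _∷_; length; map; upTo)
open import Data.List.Membership.Propositional using (_∈_; find; lose)
open import Data.List.Membership.Propositional.Properties
  using (∈-map⁺; ∈-map⁻; ∈-concatMap⁺; ∈-concatMap⁻; ∈-upTo⁺; ∈-upTo⁻)
open import Data.List.Relation.Unary.Any.Properties using (any⁺; any⁻)
open import Data.Product using (_×_; _,_; ∃; proj₁; proj₂)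
open import Data.Sum using (inj₁; inj₂)
open import Data.Empty using (⊥; ⊥-elim)
open import Function using (_∘_)
open import Function.Bundles using (_⇔_; mk⇔; Equivalence)
open import Function.Construct.Composition using (_⇔-∘_)
open import Relation.Binary.PropositionalEquality
open import Relation.Binary.Definitions using (tri<; tri≈; tri>)
open import Relation.Nullary using (Dec; yes; no; does; ¬_)
open import Relation.Nullary.Decidable using (dec-true; dec-false)

open Equivalence using (to; from)

dec-true⁻¹ : ∀ {p} {P : Set p} (P? : Dec P) → does P? ≡ true → P
dec-true⁻¹ (yes p) _ = p

dec-false⁻¹ : ∀ {p} {P : Set p} (P? : Dec P) → does P? ≡ false → ¬ P
dec-false⁻¹ (no ¬p) _ = ¬p

∧-true⁻ : ∀ b {c} → b ∧ c ≡ true → b ≡ true × c ≡ true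
∧-true⁻ true c≡true = refl , c≡true

not-true⁻ : ∀ {b} → not b ≡ true → b ≡ false
not-true⁻ {false} _ = refl

guard-yes : ∀ {p} {P : Set p} (P? : Dec P) {b} → P → does P? ∧ b ≡ b
guard-yes P? p = cong (_∧ _) (dec-true P? p)

guard-no : ∀ {p} {P : Set p} (P? : Dec P) {b} → ¬ P → does P? ∧ b ≡ false
guard-no P? ¬p = cong (_∧ _) (dec-false P? ¬p)

any-true⇔ : ∀ {A : Set} (p : A → Bool) xs → any p xs ≡ true ⇔ ∃ λ x → x ∈ xs × p x ≡ true
any-true⇔ p xs = mk⇔
  (λ h → let (x , x∈xs , px) = find (any⁻ p xs (from T-≡ h)) in x , x∈xs , to T-≡ px)
  (λ (x , x∈xs , px) → to T-≡ (any⁺ p (lose x∈xs (from T-≡ px))))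

χ-false : ∀ {b} → ¬ (b ≡ true) → χ b ≡ + 0
χ-false {true}  b≢true = ⊥-elim (b≢true refl)
χ-false {false} _      = refl

χ-sub-not : ∀ b c → χ b - χ c ≡ χ (not c) - χ (not b)
χ-sub-not true  true  = refl
χ-sub-not true  false = refl
χ-sub-not false true  = refl
χ-sub-not false false = refl

χ≤?-χ<? : ∀ u v → χ (does (u ℕ.≤? v)) - χ (does (u ℕ.<? v)) ≡ χ (does (u ℕ.≟ v))
χ≤?-χ<? u v with ℕP.<-cmp u v
... | tri< u<v u≢v _
  rewrite dec-true (u ℕ.≤? v) (ℕP.<⇒≤ u<v) | dec-true (u ℕ.<? v) u<v | dec-false (u ℕ.≟ v) u≢v = refl
... | tri≈ _ refl _
  rewrite dec-true (u ℕ.≤? u) ℕP.≤-refl | dec-false (u ℕ.<? u) (ℕP.<-irrefl refl) | dec-true (u ℕ.≟ u) refl = refl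
... | tri> _ u≢v v<u
  rewrite dec-false (u ℕ.≤? v) (ℕP.<⇒≱ v<u) | dec-false (u ℕ.<? v) (ℕP.<-asym v<u) | dec-false (u ℕ.≟ v) u≢v = refl

χ<?-when-≤ : ∀ {u v} → u ℕ.≤ v → + 1 - χ (does (u ℕ.<? v)) ≡ χ (does (u ℕ.≟ v))
χ<?-when-≤ {u} {v} u≤v =
  subst (λ b → χ b - χ (does (u ℕ.<? v)) ≡ χ (does (u ℕ.≟ v))) (dec-true (u ℕ.≤? v) u≤v) (χ≤?-χ<? u v)

count : ∀ {n} → (Fin n → Bool) → ℤ
count p = finSum (λ i → χ (p i))

finSum-cong : ∀ {n} {f g : Fin n → ℤ} → (∀ i → f i ≡ g i) → finSum f ≡ finSum g
finSum-cong {zero}  f≗g = refl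
finSum-cong {suc n} f≗g = cong₂ _+_ (f≗g Fin.zero) (finSum-cong (λ i → f≗g (Fin.suc i)))

finSum-zero : ∀ {n} (f : Fin n → ℤ) → (∀ i → f i ≡ + 0) → finSum f ≡ + 0
finSum-zero {zero}  f f≗0 = refl
finSum-zero {suc n} f f≗0
  rewrite f≗0 Fin.zero | finSum-zero (λ i → f (Fin.suc i)) (λ i → f≗0 (Fin.suc i)) = refl

finSum-single : ∀ {n} (f : Fin n → ℤ) m → (∀ i → i ≢ m → f i ≡ + 0) → finSum f ≡ f m
finSum-single {suc n} f Fin.zero vanish
  rewrite finSum-zero (λ i → f (Fin.suc i)) (λ i → vanish (Fin.suc i) (λ ())) = ℤP.+-identityʳ (f Fin.zero)
finSum-single {suc n} f (Fin.suc m) vanish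
  rewrite vanish Fin.zero (λ ())
        | finSum-single (λ i → f (Fin.suc i)) m (λ i i≢m → vanish (Fin.suc i) (i≢m ∘ FinP.suc-injective))
  = ℤP.+-identityˡ (f (Fin.suc m))

finSum-distrib-+ : ∀ {n} (f g : Fin n → ℤ) → finSum (λ i → f i + g i) ≡ finSum f + finSum g
finSum-distrib-+ {zero}  f g = refl
finSum-distrib-+ {suc n} f g
  rewrite finSum-distrib-+ (λ i → f (Fin.suc i)) (λ i → g (Fin.suc i))
  = interchange (f Fin.zero) (g Fin.zero) (finSum (λ i → f (Fin.suc i))) (finSum (λ i → g (Fin.suc i)))
  where
  interchange : ∀ a b c d → (a + b) + (c + d) ≡ (a + c) + (b + d)
  interchange = solve-∀

finSum-distrib-neg : ∀ {n} (f : Fin n → ℤ) → finSum (λ i → - f i) ≡ - finSum f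
finSum-distrib-neg {zero}  f = refl
finSum-distrib-neg {suc n} f
  rewrite finSum-distrib-neg (λ i → f (Fin.suc i)) = sym (ℤP.neg-distrib-+ (f Fin.zero) _)

finSum-distrib-- : ∀ {n} (f g : Fin n → ℤ) → finSum (λ i → f i - g i) ≡ finSum f - finSum g
finSum-distrib-- f g = trans (finSum-distrib-+ f (λ i → - g i)) (cong (λ x → finSum f + x) (finSum-distrib-neg g))

finSum-*ʳ : ∀ {n} (f : Fin n → ℤ) c → finSum (λ i → f i * c) ≡ finSum f * c
finSum-*ʳ {zero}  f c = refl
finSum-*ʳ {suc n} f c
  rewrite finSum-*ʳ (λ i → f (Fin.suc i)) c = sym (ℤP.*-distribʳ-+ c (f Fin.zero) _)

finSum-swap : ∀ {n p} (f : Fin n → Fin p → ℤ) →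
  finSum (λ i → finSum (λ j → f i j)) ≡ finSum (λ j → finSum (λ i → f i j))
finSum-swap {zero} {p} f = sym (finSum-zero {p} _ (λ _ → refl))
finSum-swap {suc n} f
  rewrite finSum-swap (λ i j → f (Fin.suc i) j) = sym (finSum-distrib-+ (f Fin.zero) _)

finSum-δ : ∀ {l} (f : Fin l → ℤ) m → finSum (λ i → f i * δ i m) ≡ f m
finSum-δ f m = begin
  finSum (λ i → f i * δ i m) ≡⟨ finSum-single _ m off-diagonal ⟩
  f m * δ m m                ≡⟨ cong (f m *_) (cong χ (dec-true (m Fin.≟ m) refl)) ⟩
  f m * + 1                  ≡⟨ ℤP.*-identityʳ (f m) ⟩
  f m                        ∎
  where
  open ≡-Reasoning
  off-diagonal : ∀ i → i ≢ m → f i * δ i m ≡ + 0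
  off-diagonal i i≢m = trans (cong (f i *_) (cong χ (dec-false (i Fin.≟ m) i≢m))) (ℤP.*-zeroʳ (f i))

finSum-combination : ∀ {n} (f g h k : Fin n → ℤ) →
  finSum (λ i → - (f i - g i) + (h i - k i)) ≡ - (finSum f - finSum g) + (finSum h - finSum k)
finSum-combination f g h k =
  trans (finSum-distrib-+ (λ i → - (f i - g i)) (λ i → h i - k i))
        (cong₂ _+_ (trans (finSum-distrib-neg (λ i → f i - g i)) (cong -_ (finSum-distrib-- f g)))
                   (finSum-distrib-- h k))

count-unique : ∀ {n} (p : Fin n → Bool) (b : Bool) →
  (∀ i j → p i ≡ true → p j ≡ true → i ≡ j) →
  (b ≡ true → ∃ λ i → p i ≡ true) →
  (∀ i → p i ≡ true → b ≡ true) →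
  count p ≡ χ b
count-unique p true unique witness _ with witness refl
... | i , pᵢ = trans (finSum-single _ i (λ j j≢i → χ-false (λ pⱼ → j≢i (unique j i pⱼ pᵢ)))) (cong χ pᵢ)
count-unique p false _ _ implies = finSum-zero _ (λ i → χ-false (λ pᵢ → false≢true (implies i pᵢ)))
  where
  false≢true : false ≢ true
  false≢true ()

-- Double counting the incidences between the indices selected by q and their images under ρ.
count-reindex : ∀ {l} N (ρ : Fin l → ℕ) (q : Fin l → Bool) (R : ℕ → Bool) →
  (∀ i → q i ≡ true → ρ i ℕ.< N) →
  (∀ i j → q i ≡ true → q j ≡ true → ρ i ≡ ρ j → i ≡ j) →
  (∀ y → R y ≡ true → ∃ λ i → q i ≡ true × ρ i ≡ y) →
  (∀ i → q i ≡ true → R (ρ i) ≡ true) →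
  count q ≡ count {N} (λ y → R (toℕ y))
count-reindex {l} N ρ q R bounded injective onto into = begin
  count q                                    ≡⟨ finSum-cong (λ i → sym (fibre-of-index i)) ⟩
  finSum (λ i → count (λ y → incident i y))  ≡⟨ finSum-swap (λ i y → χ (incident i y)) ⟩
  finSum (λ y → count (λ i → incident i y))  ≡⟨ finSum-cong fibre-of-row ⟩
  count {N} (λ y → R (toℕ y))                ∎
  where
  open ≡-Reasoning
  incident : Fin l → Fin N → Bool
  incident i y = q i ∧ does (ρ i ℕ.≟ toℕ y)
  ρ≡ : ∀ {i y} → incident i y ≡ true → ρ i ≡ toℕ y
  ρ≡ {i} {y} h = dec-true⁻¹ (ρ i ℕ.≟ toℕ y) (proj₂ (∧-true⁻ (q i) h))
  fibre-of-index : ∀ i → count (incident i) ≡ χ (q i)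
  fibre-of-index i = count-unique (incident i) (q i)
    (λ y y′ hy hy′ → FinP.toℕ-injective (trans (sym (ρ≡ hy)) (ρ≡ hy′)))
    (λ qᵢ → Fin.fromℕ< (bounded i qᵢ)
          , cong₂ _∧_ qᵢ (dec-true (ρ i ℕ.≟ _) (sym (FinP.toℕ-fromℕ< (bounded i qᵢ)))))
    (λ y h → proj₁ (∧-true⁻ (q i) h))
  fibre-of-row : ∀ y → count (λ i → incident i y) ≡ χ (R (toℕ y))
  fibre-of-row y = count-unique (λ i → incident i y) (R (toℕ y))
    (λ i j hi hj → injective i j (proj₁ (∧-true⁻ (q i) hi)) (proj₁ (∧-true⁻ (q j) hj)) (trans (ρ≡ hi) (sym (ρ≡ hj))))
    (λ Ry → let (i , qᵢ , ρᵢ) = onto (toℕ y) Ry in i , cong₂ _∧_ qᵢ (dec-true (ρ i ℕ.≟ toℕ y) ρᵢ))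
    (λ i h → subst (λ z → R z ≡ true) (ρ≡ h) (into i (proj₁ (∧-true⁻ (q i) h))))

posRoot : ∀ {l} → (Fin l → Fin l → Bool) → Fin l → Fin l → Bool
posRoot A i j = does (i Fin.<? j) ∧ A i j

sumRoots-count : ∀ {l} (A : Fin l → Fin l → Bool) m →
  sumRoots A m ≡ count (posRoot A m) - count (λ i → posRoot A i m)
sumRoots-count A m = begin
  sumRoots A m
    ≡⟨ finSum-cong (λ i → trans (finSum-cong (λ j → if-split (α i j) (δ i m) (δ j m)))
                                (finSum-distrib-- (λ j → χ (α i j) * δ i m) (λ j → χ (α i j) * δ j m))) ⟩
  finSum (λ i → finSum (λ j → χ (α i j) * δ i m) - finSum (λ j → χ (α i j) * δ j m))
    ≡⟨ finSum-distrib-- (λ i → finSum (λ j → χ (α i j) * δ i m)) (λ i → finSum (λ j → χ (α i j) * δ j m)) ⟩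
  finSum (λ i → finSum (λ j → χ (α i j) * δ i m)) - finSum (λ i → finSum (λ j → χ (α i j) * δ j m))
    ≡⟨ cong₂ _-_ (trans (finSum-cong (λ i → finSum-*ʳ (λ j → χ (α i j)) (δ i m))) (finSum-δ (λ i → count (α i)) m))
                 (finSum-cong (λ i → finSum-δ (λ j → χ (α i j)) m)) ⟩
  count (posRoot A m) - count (λ i → posRoot A i m)
    ∎
  where
  open ≡-Reasoning
  α = posRoot A
  if-split : ∀ b x y → (if b then x - y else + 0) ≡ χ b * x - χ b * y
  if-split true  x y = sym (cong₂ _-_ (ℤP.*-identityˡ x) (ℤP.*-identityˡ y))
  if-split false x y = refl

quot-rem-mono : ∀ K {c c′ : ℤ} {s s′ : ℕ} → s ℕ.< suc K → c ℤ.< c′ → + suc K * c + + s ℤ.< + suc K * c′ + + s′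
quot-rem-mono K {c} {c′} {s} {s′} s<K c<c′ = begin-strict
  + suc K * c + + s      <⟨ ℤP.+-monoʳ-< (+ suc K * c) (ℤ.+<+ s<K) ⟩
  + suc K * c + + suc K  ≡⟨ distrib (+ suc K) c ⟩
  + suc K * (+ 1 + c)    ≤⟨ ℤP.*-monoˡ-≤-nonNeg (+ suc K) (ℤP.i<j⇒suc[i]≤j c<c′) ⟩
  + suc K * c′           ≤⟨ ℤP.i≤i+j (+ suc K * c′) (+ s′) ⟩
  + suc K * c′ + + s′    ∎
  where
  open ℤP.≤-Reasoning
  distrib : ∀ a c → a * c + a ≡ a * (+ 1 + c)
  distrib = solve-∀

quot-rem-unique : ∀ K {c₁ c₂ : ℤ} {s₁ s₂ : ℕ} → s₁ ℕ.< suc K → s₂ ℕ.< suc K →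
  + suc K * c₁ + + s₁ ≡ + suc K * c₂ + + s₂ → c₁ ≡ c₂ × s₁ ≡ s₂
quot-rem-unique K {c₁} {c₂} s₁<K s₂<K eq with ℤP.<-cmp c₁ c₂
... | tri< c₁<c₂ _ _ = ⊥-elim (ℤP.<-irrefl eq (quot-rem-mono K s₁<K c₁<c₂))
... | tri> _ _ c₂<c₁ = ⊥-elim (ℤP.<-irrefl (sym eq) (quot-rem-mono K s₂<K c₂<c₁))
... | tri≈ _ refl _ = refl , ℤP.+-injective (∙-cancelˡ (+ suc K * c₁) _ _ eq)

diff-offset⇔ : ∀ a b c d t → (+ a - + b + + t ≡ + c - + d) ⇔ (c ℕ.+ b ≡ t ℕ.+ (a ℕ.+ d))
diff-offset⇔ a b c d t = mk⇔ forward backward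
  where
  open ≡-Reasoning
  embed : + (t ℕ.+ (a ℕ.+ d)) ≡ + t + (+ a + + d)
  embed = trans (ℤP.pos-+ t (a ℕ.+ d)) (cong (λ z → + t + z) (ℤP.pos-+ a d))
  shuffle₁ : ∀ c b d → c + b ≡ (c - d) + (b + d)
  shuffle₁ = solve-∀
  shuffle₂ : ∀ a b d t → (a - b + t) + (b + d) ≡ t + (a + d)
  shuffle₂ = solve-∀
  shuffle₃ : ∀ a b d t → a - b + t ≡ (t + (a + d)) - (b + d)
  shuffle₃ = solve-∀
  shuffle₄ : ∀ c b d → (c + b) - (b + d) ≡ c - d
  shuffle₄ = solve-∀
  forward : + a - + b + + t ≡ + c - + d → c ℕ.+ b ≡ t ℕ.+ (a ℕ.+ d)
  forward h = ℤP.+-injective (begin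
    + (c ℕ.+ b)                      ≡⟨ ℤP.pos-+ c b ⟩
    + c + + b                        ≡⟨ shuffle₁ (+ c) (+ b) (+ d) ⟩
    (+ c - + d) + (+ b + + d)        ≡⟨ cong (λ z → z + (+ b + + d)) (sym h) ⟩
    (+ a - + b + + t) + (+ b + + d)  ≡⟨ shuffle₂ (+ a) (+ b) (+ d) (+ t) ⟩
    + t + (+ a + + d)                ≡⟨ sym embed ⟩
    + (t ℕ.+ (a ℕ.+ d))              ∎)
  backward : c ℕ.+ b ≡ t ℕ.+ (a ℕ.+ d) → + a - + b + + t ≡ + c - + d
  backward h = begin
    + a - + b + + t                    ≡⟨ shuffle₃ (+ a) (+ b) (+ d) (+ t) ⟩
    (+ t + (+ a + + d)) - (+ b + + d)  ≡⟨ cong (λ z → z - (+ b + + d)) (trans (sym embed) (cong +_ (sym h))) ⟩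
    + (c ℕ.+ b) - (+ b + + d)          ≡⟨ cong (λ z → z - (+ b + + d)) (ℤP.pos-+ c b) ⟩
    (+ c + + b) - (+ b + + d)          ≡⟨ shuffle₄ (+ c) (+ b) (+ d) ⟩
    + c - + d                          ∎

-- adj is (k+1)·content plus a shape index in [1, k], so it determines both.
adj-offset⇔ : ∀ {k} (x y : Box k) t →
  (adj x + + t * shift k ≡ adj y) ⇔ (shp x ≡ shp y × col y ℕ.+ row x ≡ t ℕ.+ (col x ℕ.+ row y))
adj-offset⇔ {k} x y t = mk⇔ forward backward
  where
  K = + suc k
  index< : ∀ (z : Box k) → suc (toℕ (shp z)) ℕ.< suc k
  index< z = ℕ.s≤s (FinP.toℕ<n (shp z))
  regroup′ : ∀ K c s t → (K * c + s) + t * K ≡ K * (c + t) + s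
  regroup′ = solve-∀
  regroup : adj x + + t * shift k ≡ K * (content x + + t) + + suc (toℕ (shp x))
  regroup = regroup′ K (content x) (+ suc (toℕ (shp x))) (+ t)
  forward : adj x + + t * shift k ≡ adj y → shp x ≡ shp y × col y ℕ.+ row x ≡ t ℕ.+ (col x ℕ.+ row y)
  forward h with quot-rem-unique k (index< x) (index< y) (trans (sym regroup) h)
  ... | content≡ , index≡ =
    FinP.toℕ-injective (ℕP.suc-injective index≡) , to (diff-offset⇔ (col x) (row x) (col y) (row y) t) content≡
  backward : shp x ≡ shp y × col y ℕ.+ row x ≡ t ℕ.+ (col x ℕ.+ row y) → adj x + + t * shift k ≡ adj y
  backward (shp≡ , diag≡) =
    trans regroup (cong₂ (λ c s → K * c + + suc (toℕ s))
                         (from (diff-offset⇔ (col x) (row x) (col y) (row y) t) diag≡) shp≡)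

adj-≡⇔ : ∀ {k} (x y : Box k) →
  adj x ≡ adj y ⇔ (shp x ≡ shp y × col y ℕ.+ row x ≡ col x ℕ.+ row y)
adj-≡⇔ x y =
  subst (λ z → (z ≡ adj y) ⇔ (shp x ≡ shp y × col y ℕ.+ row x ≡ col x ℕ.+ row y))
        (ℤP.+-identityʳ (adj x)) (adj-offset⇔ x y 0)

adj-+shift⇔ : ∀ {k} (x y : Box k) →
  adj x + shift k ≡ adj y ⇔ (shp x ≡ shp y × col y ℕ.+ row x ≡ suc (col x ℕ.+ row y))
adj-+shift⇔ {k} x y =
  subst (λ z → (z ≡ adj y) ⇔ (shp x ≡ shp y × col y ℕ.+ row x ≡ suc (col x ℕ.+ row y)))
        (cong (λ z → adj x + z) (ℤP.*-identityˡ (shift k))) (adj-offset⇔ x y 1)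

<at⇒<length : ∀ xs r {c} → c ℕ.< at xs r → r ℕ.< length xs
<at⇒<length []       r       ()
<at⇒<length (x ∷ xs) zero    _   = ℕ.s≤s ℕ.z≤n
<at⇒<length (x ∷ xs) (suc r) c<x = ℕ.s≤s (<at⇒<length xs r c<x)

antitone-from-steps : ∀ (f : ℕ → ℕ) → (∀ n → f (suc n) ℕ.≤ f n) → ∀ {m n} → m ℕ.≤ n → f n ℕ.≤ f m
antitone-from-steps f step m≤n = go (ℕP.≤⇒≤′ m≤n)
  where
  go : ∀ {m n} → m ℕ.≤′ n → f n ℕ.≤ f m
  go ℕ.≤′-refl       = ℕP.≤-refl
  go (ℕ.≤′-step m≤n) = ℕP.≤-trans (step _) (go m≤n)

crossing-not-twice : ∀ (f : ℕ → ℕ) → (∀ {m n} → m ℕ.≤ n → f n ℕ.≤ f m) →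
  ∀ {c d u v} → u ℕ.< v → f u ℕ.+ c ≡ d ℕ.+ u → f v ℕ.+ c ≡ d ℕ.+ v → ⊥
crossing-not-twice f antitone {c} {d} {u} {v} u<v crosses-u crosses-v = ℕP.<⇒≱ u<v
  (ℕP.+-cancelˡ-≤ d v u (subst₂ ℕ._≤_ crosses-v crosses-u (ℕP.+-monoˡ-≤ c (antitone (ℕP.<⇒≤ u<v)))))

crossing-unique : ∀ (f : ℕ → ℕ) → (∀ {m n} → m ℕ.≤ n → f n ℕ.≤ f m) →
  ∀ {c d y y′} → f y ℕ.+ c ≡ d ℕ.+ y → f y′ ℕ.+ c ≡ d ℕ.+ y′ → y ≡ y′
crossing-unique f antitone {y = y} {y′} crosses crosses′ with ℕP.<-cmp y y′
... | tri< y<y′ _ _ = ⊥-elim (crossing-not-twice f antitone y<y′ crosses crosses′)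
... | tri≈ _ y≡y′ _ = y≡y′
... | tri> _ _ y′<y = ⊥-elim (crossing-not-twice f antitone y′<y crosses′ crosses)

∈cells⇔ : ∀ S c r → (c , r) ∈ cells S ⇔ InSkew S c r
∈cells⇔ S c r = mk⇔ sound complete
  where
  row-cells : ℕ → List (ℕ × ℕ)
  row-cells r = map (λ c → (c , r)) (range (at (inner S) r) (at (outer S) r))
  sound : (c , r) ∈ cells S → InSkew S c r
  sound c∈ with find (∈-concatMap⁻ row-cells {xs = upTo (length (outer S))} c∈)
  ... | r′ , _ , c∈row with ∈-map⁻ (λ c → (c , r′)) c∈row
  ...   | c′ , c′∈range , refl with ∈-map⁻ (at (inner S) r′ ℕ.+_) c′∈range
  ...     | d , d∈ , refl = ℕP.m≤m+n _ d , subst (at (inner S) r′ ℕ.+ d ℕ.<_) (ℕP.m+[n∸m]≡n (contained S r′))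
                                                 (ℕP.+-monoʳ-< (at (inner S) r′) (∈-upTo⁻ d∈))
  complete : InSkew S c r → (c , r) ∈ cells S
  complete (μ≤c , c<λ) =
    ∈-concatMap⁺ row-cells (lose {P = λ r′ → (c , r) ∈ row-cells r′} (∈-upTo⁺ (<at⇒<length (outer S) r c<λ))
                                 (∈-map⁺ (λ c → (c , r)) c∈range))
    where
    c∈range : c ∈ range (at (inner S) r) (at (outer S) r)
    c∈range = subst (_∈ range (at (inner S) r) (at (outer S) r)) (ℕP.m+[n∸m]≡n μ≤c)
                    (∈-map⁺ (at (inner S) r ℕ.+_) (∈-upTo⁺ (ℕP.∸-monoˡ-< c<λ μ≤c)))

lineMeetsRow : Skew → (r P y : ℕ) → Bool
lineMeetsRow S r P y = does (at (inner S) y ℕ.+ r ℕ.≤? P ℕ.+ y) ∧ does (P ℕ.+ y ℕ.<? at (outer S) y ℕ.+ r)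

lineMeetsRow⇔ : ∀ S r P y → lineMeetsRow S r P y ≡ true ⇔ ∃ λ x → x ℕ.+ r ≡ P ℕ.+ y × InSkew S x y
lineMeetsRow⇔ S r P y = mk⇔ forward backward
  where
  μ = at (inner S) y
  λ′ = at (outer S) y
  forward : lineMeetsRow S r P y ≡ true → ∃ λ x → x ℕ.+ r ≡ P ℕ.+ y × InSkew S x y
  forward h with ∧-true⁻ (does (μ ℕ.+ r ℕ.≤? P ℕ.+ y)) h
  ... | lo , hi = P ℕ.+ y ∸ r , on-line
                , ℕP.+-cancelʳ-≤ r μ _ (subst (μ ℕ.+ r ℕ.≤_) (sym on-line) μ+r≤)
                , ℕP.+-cancelʳ-< r _ λ′ (subst (ℕ._< λ′ ℕ.+ r) (sym on-line)
                                               (dec-true⁻¹ (P ℕ.+ y ℕ.<? λ′ ℕ.+ r) hi))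
    where
    μ+r≤ = dec-true⁻¹ (μ ℕ.+ r ℕ.≤? P ℕ.+ y) lo
    on-line : P ℕ.+ y ∸ r ℕ.+ r ≡ P ℕ.+ y
    on-line = ℕP.m∸n+n≡m (ℕP.≤-trans (ℕP.m≤n+m r μ) μ+r≤)
  backward : (∃ λ x → x ℕ.+ r ≡ P ℕ.+ y × InSkew S x y) → lineMeetsRow S r P y ≡ true
  backward (x , on-line , μ≤x , x<λ) =
    cong₂ _∧_ (dec-true (μ ℕ.+ r ℕ.≤? P ℕ.+ y) (subst (μ ℕ.+ r ℕ.≤_) on-line (ℕP.+-monoˡ-≤ r μ≤x)))
              (dec-true (P ℕ.+ y ℕ.<? λ′ ℕ.+ r) (subst (ℕ._< λ′ ℕ.+ r) on-line (ℕP.+-monoˡ-< r x<λ)))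

lineMeetsRow-≡upper : ∀ S r P y → at (inner S) y ℕ.+ r ℕ.≤ P ℕ.+ y →
  lineMeetsRow S r P y ≡ does (P ℕ.+ y ℕ.<? at (outer S) y ℕ.+ r)
lineMeetsRow-≡upper S r P y lo = guard-yes (at (inner S) y ℕ.+ r ℕ.≤? P ℕ.+ y) lo

lineMeetsRow-≡lower : ∀ S r P y → P ℕ.+ y ℕ.< at (outer S) y ℕ.+ r →
  lineMeetsRow S r P y ≡ does (at (inner S) y ℕ.+ r ℕ.≤? P ℕ.+ y)
lineMeetsRow-≡lower S r P y hi =
  trans (cong (does (at (inner S) y ℕ.+ r ℕ.≤? P ℕ.+ y) ∧_) (dec-true (P ℕ.+ y ℕ.<? at (outer S) y ℕ.+ r) hi))
        (∧-identityʳ _)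

count-rows≡χ-any : ∀ N (F : ℕ → Bool) (p : ℕ × ℕ → Bool) (cs : List (ℕ × ℕ)) →
  (∀ {y y′} → F y ≡ true → F y′ ≡ true → y ≡ y′) →
  (∀ {c y} → (c , y) ∈ cs → p (c , y) ≡ true → F y ≡ true × y ℕ.< N) →
  (∀ {y} → F y ≡ true → ∃ λ c → (c , y) ∈ cs × p (c , y) ≡ true) →
  count {N} (λ y → F (toℕ y)) ≡ χ (any p cs)
count-rows≡χ-any N F p cs unique sound complete = count-unique (λ y → F (toℕ y)) (any p cs)
  (λ i j Fᵢ Fⱼ → FinP.toℕ-injective (unique Fᵢ Fⱼ))
  (λ any-p → let ((c , y) , c∈ , pc) = to (any-true⇔ p cs) any-p
                 (Fy , y<N) = sound c∈ pc
             in Fin.fromℕ< y<N , subst (λ z → F z ≡ true) (sym (FinP.toℕ-fromℕ< y<N)) Fy)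
  (λ i Fᵢ → let (c , c∈ , pc) = complete Fᵢ in from (any-true⇔ p cs) (_ , c∈ , pc))

module RowCount {k} (S : Skew) (a : Box k) (a∈S : InSkew S (col a) (row a)) where

  private
    x₀ r₀ N : ℕ
    x₀ = col a
    r₀ = row a
    N = length (outer S)
    μ λ′ : ℕ → ℕ
    μ = at (inner S)
    λ′ = at (outer S)
    μr₀≤x₀ : μ r₀ ℕ.≤ x₀
    μr₀≤x₀ = proj₁ a∈S
    x₀<λr₀ : x₀ ℕ.< λ′ r₀
    x₀<λr₀ = proj₂ a∈S
    μ-antitone : ∀ {m n} → m ℕ.≤ n → μ n ℕ.≤ μ m
    μ-antitone = antitone-from-steps μ (inner-dec S)
    λ-antitone : ∀ {m n} → m ℕ.≤ n → λ′ n ℕ.≤ λ′ m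
    λ-antitone = antitone-from-steps λ′ (outer-dec S)

  -- The guards in firstOnDiag and lastOnDiag are implied (first boxes on D(a) lie weakly below a,
  -- last boxes weakly above), but they turn the row identity into a case split on y versus r₀.
  onDiagBelow onDiagAbove onNextDiagAbove onPrevDiagBelow firstOnDiag lastOnDiag : ℕ → Bool
  onDiagBelow     y = does (y ℕ.<? r₀) ∧ lineMeetsRow S r₀ x₀ y
  onDiagAbove     y = does (r₀ ℕ.<? y) ∧ lineMeetsRow S r₀ x₀ y
  onNextDiagAbove y = does (r₀ ℕ.≤? y) ∧ lineMeetsRow S r₀ (suc x₀) y
  onPrevDiagBelow y = does (y ℕ.≤? r₀) ∧ lineMeetsRow S (suc r₀) x₀ y
  firstOnDiag     y = does (y ℕ.≤? r₀) ∧ does (μ y ℕ.+ r₀ ℕ.≟ x₀ ℕ.+ y)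
  lastOnDiag      y = does (r₀ ℕ.≤? y) ∧ does (suc (x₀ ℕ.+ y) ℕ.≟ λ′ y ℕ.+ r₀)

  RowIdentity : (above below nextAbove prevBelow first last : Bool) → Set
  RowIdentity above below nextAbove prevBelow first last =
    - (χ above - χ below) + (χ nextAbove - χ prevBelow) ≡ χ first - χ last

  RowIdentity-cong : ∀ {a a′ b b′ n n′ p p′ f f′ l l′} →
    a ≡ a′ → b ≡ b′ → n ≡ n′ → p ≡ p′ → f ≡ f′ → l ≡ l′ →
    RowIdentity a′ b′ n′ p′ f′ l′ → RowIdentity a b n p f l
  RowIdentity-cong refl refl refl refl refl refl identity = identity

  row-identity-below : ∀ {y} → y ℕ.< r₀ →
    RowIdentity (onDiagAbove y) (onDiagBelow y) (onNextDiagAbove y) (onPrevDiagBelow y) (firstOnDiag y) (lastOnDiag y)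
  row-identity-below {y} y<r₀ =
    RowIdentity-cong above≡ below≡ next≡ prev≡ first≡ last≡
      (trans (regroup (χ (does (μ y ℕ.+ r₀ ℕ.≤? x₀ ℕ.+ y))) (χ (does (μ y ℕ.+ r₀ ℕ.<? x₀ ℕ.+ y))))
             (cong (_- + 0) (χ≤?-χ<? (μ y ℕ.+ r₀) (x₀ ℕ.+ y))))
    where
    y≤r₀ = ℕP.<⇒≤ y<r₀
    right-of-diag : x₀ ℕ.+ y ℕ.< λ′ y ℕ.+ r₀
    right-of-diag = ℕP.+-mono-<-≤ (ℕP.<-≤-trans x₀<λr₀ (λ-antitone y≤r₀)) y≤r₀
    above≡ : onDiagAbove y ≡ false
    above≡ = guard-no (r₀ ℕ.<? y) (ℕP.<-asym y<r₀)
    below≡ : onDiagBelow y ≡ does (μ y ℕ.+ r₀ ℕ.≤? x₀ ℕ.+ y)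
    below≡ = trans (guard-yes (y ℕ.<? r₀) y<r₀) (lineMeetsRow-≡lower S r₀ x₀ y right-of-diag)
    next≡ : onNextDiagAbove y ≡ false
    next≡ = guard-no (r₀ ℕ.≤? y) (ℕP.<⇒≱ y<r₀)
    prev≡ : onPrevDiagBelow y ≡ does (μ y ℕ.+ r₀ ℕ.<? x₀ ℕ.+ y)
    prev≡ = trans (guard-yes (y ℕ.≤? r₀) y≤r₀)
           (trans (lineMeetsRow-≡lower S (suc r₀) x₀ y
                    (ℕP.<-≤-trans right-of-diag (ℕP.+-monoʳ-≤ (λ′ y) (ℕP.n≤1+n r₀))))
                  (cong (λ z → does (z ℕ.≤? x₀ ℕ.+ y)) (ℕP.+-suc (μ y) r₀)))
    first≡ : firstOnDiag y ≡ does (μ y ℕ.+ r₀ ℕ.≟ x₀ ℕ.+ y)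
    first≡ = guard-yes (y ℕ.≤? r₀) y≤r₀
    last≡ : lastOnDiag y ≡ false
    last≡ = guard-no (r₀ ℕ.≤? y) (ℕP.<⇒≱ y<r₀)
    regroup : ∀ b p → - (+ 0 - b) + (+ 0 - p) ≡ (b - p) - + 0
    regroup = solve-∀

  row-identity-at : RowIdentity (onDiagAbove r₀) (onDiagBelow r₀) (onNextDiagAbove r₀) (onPrevDiagBelow r₀)
                                (firstOnDiag r₀) (lastOnDiag r₀)
  row-identity-at =
    RowIdentity-cong above≡ below≡ next≡ prev≡ first≡ last≡
      (trans (regroup (χ (does (suc x₀ ℕ.+ r₀ ℕ.<? λ′ r₀ ℕ.+ r₀))) (χ (does (μ r₀ ℕ.+ r₀ ℕ.<? x₀ ℕ.+ r₀))))
             (cong₂ _-_ (χ<?-when-≤ (ℕP.+-monoˡ-≤ r₀ μr₀≤x₀)) (χ<?-when-≤ (ℕP.+-monoˡ-< r₀ x₀<λr₀))))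
    where
    above≡ : onDiagAbove r₀ ≡ false
    above≡ = guard-no (r₀ ℕ.<? r₀) (ℕP.<-irrefl refl)
    below≡ : onDiagBelow r₀ ≡ false
    below≡ = guard-no (r₀ ℕ.<? r₀) (ℕP.<-irrefl refl)
    next≡ : onNextDiagAbove r₀ ≡ does (suc x₀ ℕ.+ r₀ ℕ.<? λ′ r₀ ℕ.+ r₀)
    next≡ = trans (guard-yes (r₀ ℕ.≤? r₀) ℕP.≤-refl)
                  (lineMeetsRow-≡upper S r₀ (suc x₀) r₀ (ℕP.+-monoˡ-≤ r₀ (ℕP.m≤n⇒m≤1+n μr₀≤x₀)))
    prev≡ : onPrevDiagBelow r₀ ≡ does (μ r₀ ℕ.+ r₀ ℕ.<? x₀ ℕ.+ r₀)
    prev≡ = trans (guard-yes (r₀ ℕ.≤? r₀) ℕP.≤-refl)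
           (trans (lineMeetsRow-≡lower S (suc r₀) x₀ r₀ (ℕP.+-mono-<-≤ x₀<λr₀ (ℕP.n≤1+n r₀)))
                  (cong (λ z → does (z ℕ.≤? x₀ ℕ.+ r₀)) (ℕP.+-suc (μ r₀) r₀)))
    first≡ : firstOnDiag r₀ ≡ does (μ r₀ ℕ.+ r₀ ℕ.≟ x₀ ℕ.+ r₀)
    first≡ = guard-yes (r₀ ℕ.≤? r₀) ℕP.≤-refl
    last≡ : lastOnDiag r₀ ≡ does (suc (x₀ ℕ.+ r₀) ℕ.≟ λ′ r₀ ℕ.+ r₀)
    last≡ = guard-yes (r₀ ℕ.≤? r₀) ℕP.≤-refl
    regroup : ∀ n p → - (+ 0 - + 0) + (n - p) ≡ (+ 1 - p) - (+ 1 - n)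
    regroup = solve-∀

  row-identity-above : ∀ {y} → r₀ ℕ.< y →
    RowIdentity (onDiagAbove y) (onDiagBelow y) (onNextDiagAbove y) (onPrevDiagBelow y) (firstOnDiag y) (lastOnDiag y)
  row-identity-above {y} r₀<y =
    RowIdentity-cong above≡ below≡ next≡ prev≡ first≡ last≡
      (trans (regroup (χ (does (x₀ ℕ.+ y ℕ.<? λ′ y ℕ.+ r₀))) (χ (does (suc x₀ ℕ.+ y ℕ.<? λ′ y ℕ.+ r₀))))
             (cong (λ z → + 0 - z) (χ≤?-χ<? (suc (x₀ ℕ.+ y)) (λ′ y ℕ.+ r₀))))
    where
    r₀≤y = ℕP.<⇒≤ r₀<y
    left-of-diag : μ y ℕ.+ r₀ ℕ.≤ x₀ ℕ.+ y
    left-of-diag = ℕP.+-mono-≤ (ℕP.≤-trans (μ-antitone r₀≤y) μr₀≤x₀) r₀≤y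
    above≡ : onDiagAbove y ≡ does (x₀ ℕ.+ y ℕ.<? λ′ y ℕ.+ r₀)
    above≡ = trans (guard-yes (r₀ ℕ.<? y) r₀<y) (lineMeetsRow-≡upper S r₀ x₀ y left-of-diag)
    below≡ : onDiagBelow y ≡ false
    below≡ = guard-no (y ℕ.<? r₀) (ℕP.<-asym r₀<y)
    next≡ : onNextDiagAbove y ≡ does (suc x₀ ℕ.+ y ℕ.<? λ′ y ℕ.+ r₀)
    next≡ = trans (guard-yes (r₀ ℕ.≤? y) r₀≤y)
                  (lineMeetsRow-≡upper S r₀ (suc x₀) y (ℕP.m≤n⇒m≤1+n left-of-diag))
    prev≡ : onPrevDiagBelow y ≡ false
    prev≡ = guard-no (y ℕ.≤? r₀) (ℕP.<⇒≱ r₀<y)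
    first≡ : firstOnDiag y ≡ false
    first≡ = guard-no (y ℕ.≤? r₀) (ℕP.<⇒≱ r₀<y)
    last≡ : lastOnDiag y ≡ does (suc (x₀ ℕ.+ y) ℕ.≟ λ′ y ℕ.+ r₀)
    last≡ = guard-yes (r₀ ℕ.≤? y) r₀≤y
    regroup : ∀ b n → - (b - + 0) + (n - + 0) ≡ + 0 - (b - n)
    regroup = solve-∀

  row-identity : ∀ y →
    RowIdentity (onDiagAbove y) (onDiagBelow y) (onNextDiagAbove y) (onPrevDiagBelow y) (firstOnDiag y) (lastOnDiag y)
  row-identity y with ℕP.<-cmp y r₀
  ... | tri< y<r₀ _ _ = row-identity-below y<r₀
  ... | tri≈ _ refl _ = row-identity-at
  ... | tri> _ _ r₀<y = row-identity-above r₀<y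

  private
    row<N : ∀ {c y} → (c , y) ∈ cells S → y ℕ.< N
    row<N {c} {y} c∈S = <at⇒<length (outer S) y (proj₂ (to (∈cells⇔ S c y) c∈S))

  count-firstOnDiag : count {N} (λ y → firstOnDiag (toℕ y)) ≡ χ (any (λ p → onDiag a p ∧ isFirst S p) (cells S))
  count-firstOnDiag = count-rows≡χ-any N firstOnDiag _ (cells S)
    (λ {y} {y′} Fy Fy′ → crossing-unique μ μ-antitone (crosses y Fy) (crosses y′ Fy′))
    sound complete
    where
    crosses : ∀ y → firstOnDiag y ≡ true → μ y ℕ.+ r₀ ≡ x₀ ℕ.+ y
    crosses y h = dec-true⁻¹ (μ y ℕ.+ r₀ ℕ.≟ x₀ ℕ.+ y) (proj₂ (∧-true⁻ (does (y ℕ.≤? r₀)) h))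
    sound : ∀ {c y} → (c , y) ∈ cells S → onDiag a (c , y) ∧ isFirst S (c , y) ≡ true → firstOnDiag y ≡ true × y ℕ.< N
    sound {c} {y} c∈S h = cong₂ _∧_ (dec-true (y ℕ.≤? r₀) (ℕP.≮⇒≥ not-above))
                                    (dec-true (μ y ℕ.+ r₀ ℕ.≟ x₀ ℕ.+ y) crossing)
                        , row<N c∈S
      where
      on-diag×first = ∧-true⁻ (onDiag a (c , y)) h
      crossing : μ y ℕ.+ r₀ ≡ x₀ ℕ.+ y
      crossing = subst (λ z → z ℕ.+ r₀ ≡ x₀ ℕ.+ y) (dec-true⁻¹ (c ℕ.≟ μ y) (proj₂ on-diag×first))
                       (dec-true⁻¹ (c ℕ.+ r₀ ℕ.≟ x₀ ℕ.+ y) (proj₁ on-diag×first))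
      not-above : ¬ r₀ ℕ.< y
      not-above r₀<y = ℕP.<-irrefl crossing
        (ℕP.≤-<-trans (ℕP.+-monoˡ-≤ r₀ (ℕP.≤-trans (μ-antitone (ℕP.<⇒≤ r₀<y)) μr₀≤x₀)) (ℕP.+-monoʳ-< x₀ r₀<y))
    complete : ∀ {y} → firstOnDiag y ≡ true → ∃ λ c → (c , y) ∈ cells S × onDiag a (c , y) ∧ isFirst S (c , y) ≡ true
    complete {y} h = μ y , from (∈cells⇔ S (μ y) y) (ℕP.≤-refl , μ<λ)
                   , cong₂ _∧_ (dec-true (μ y ℕ.+ r₀ ℕ.≟ x₀ ℕ.+ y) (crosses y h)) (dec-true (μ y ℕ.≟ μ y) refl)
      where
      y≤r₀ = dec-true⁻¹ (y ℕ.≤? r₀) (proj₁ (∧-true⁻ (does (y ℕ.≤? r₀)) h))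
      μ<λ : μ y ℕ.< λ′ y
      μ<λ = ℕP.+-cancelʳ-< r₀ (μ y) (λ′ y) (subst (ℕ._< λ′ y ℕ.+ r₀) (sym (crosses y h))
              (ℕP.≤-<-trans (ℕP.+-monoʳ-≤ x₀ y≤r₀)
                (ℕP.<-≤-trans (ℕP.+-monoˡ-< r₀ x₀<λr₀) (ℕP.+-monoˡ-≤ r₀ (λ-antitone y≤r₀)))))

  count-lastOnDiag : count {N} (λ y → lastOnDiag (toℕ y)) ≡ χ (any (λ p → onDiag a p ∧ isLast S p) (cells S))
  count-lastOnDiag = count-rows≡χ-any N lastOnDiag _ (cells S)
    (λ {y} {y′} Ly Ly′ → crossing-unique λ′ λ-antitone (sym (crosses y Ly)) (sym (crosses y′ Ly′)))
    sound complete
    where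
    crosses : ∀ y → lastOnDiag y ≡ true → suc (x₀ ℕ.+ y) ≡ λ′ y ℕ.+ r₀
    crosses y h = dec-true⁻¹ (suc (x₀ ℕ.+ y) ℕ.≟ λ′ y ℕ.+ r₀) (proj₂ (∧-true⁻ (does (r₀ ℕ.≤? y)) h))
    sound : ∀ {c y} → (c , y) ∈ cells S → onDiag a (c , y) ∧ isLast S (c , y) ≡ true → lastOnDiag y ≡ true × y ℕ.< N
    sound {c} {y} c∈S h = cong₂ _∧_ (dec-true (r₀ ℕ.≤? y) (ℕP.≮⇒≥ not-below))
                                    (dec-true (suc (x₀ ℕ.+ y) ℕ.≟ λ′ y ℕ.+ r₀) crossing)
                        , row<N c∈S
      where
      on-diag×last = ∧-true⁻ (onDiag a (c , y)) h
      crossing : suc (x₀ ℕ.+ y) ≡ λ′ y ℕ.+ r₀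
      crossing = trans (cong suc (sym (dec-true⁻¹ (c ℕ.+ r₀ ℕ.≟ x₀ ℕ.+ y) (proj₁ on-diag×last))))
                       (cong (ℕ._+ r₀) (dec-true⁻¹ (suc c ℕ.≟ λ′ y) (proj₂ on-diag×last)))
      not-below : ¬ y ℕ.< r₀
      not-below y<r₀ = ℕP.<-irrefl crossing
        (ℕP.<-≤-trans (ℕP.≤-<-trans (ℕP.+-monoʳ-< x₀ y<r₀) (ℕP.+-monoˡ-< r₀ x₀<λr₀))
                      (ℕP.+-monoˡ-≤ r₀ (λ-antitone (ℕP.<⇒≤ y<r₀))))
    complete : ∀ {y} → lastOnDiag y ≡ true → ∃ λ c → (c , y) ∈ cells S × onDiag a (c , y) ∧ isLast S (c , y) ≡ true
    complete {y} h = c , from (∈cells⇔ S c y) (μ≤c , ℕP.≤-reflexive c+1≡λ)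
                   , cong₂ _∧_ (dec-true (c ℕ.+ r₀ ℕ.≟ x₀ ℕ.+ y) on-diag) (dec-true (suc c ℕ.≟ λ′ y) c+1≡λ)
      where
      r₀≤y = dec-true⁻¹ (r₀ ℕ.≤? y) (proj₁ (∧-true⁻ (does (r₀ ℕ.≤? y)) h))
      c = x₀ ℕ.+ (y ∸ r₀)
      on-diag : c ℕ.+ r₀ ≡ x₀ ℕ.+ y
      on-diag = trans (ℕP.+-assoc x₀ (y ∸ r₀) r₀) (cong (x₀ ℕ.+_) (ℕP.m∸n+n≡m r₀≤y))
      c+1≡λ : suc c ≡ λ′ y
      c+1≡λ = ℕP.+-cancelʳ-≡ r₀ (suc c) (λ′ y) (trans (cong suc on-diag) (crosses y h))
      μ≤c : μ y ℕ.≤ c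
      μ≤c = ℕP.≤-trans (μ-antitone r₀≤y) (ℕP.≤-trans μr₀≤x₀ (ℕP.m≤m+n x₀ (y ∸ r₀)))

ReadingBefore-asym : ∀ {k} {a b : Box k} → ReadingBefore a b → ReadingBefore b a → ⊥
ReadingBefore-asym (inj₁ a<b)        (inj₁ b<a)        = ℤP.<-asym a<b b<a
ReadingBefore-asym (inj₁ a<b)        (inj₂ (b≡a , _))  = ℤP.<-irrefl (sym b≡a) a<b
ReadingBefore-asym (inj₂ (a≡b , _))  (inj₁ b<a)        = ℤP.<-irrefl (sym a≡b) b<a
ReadingBefore-asym (inj₂ (_ , a<b))  (inj₂ (_ , b<a))  = ℕP.<-asym a<b b<a

Box-≡ : ∀ {k} {x y : Box k} → shp x ≡ shp y → col x ≡ col y → row x ≡ row y → x ≡ y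
Box-≡ {x = box s c r} {box .s .c .r} refl refl refl = refl

module ReadingEnum {k l} (ν : Fin k → Skew) (e : Fin l → Box k) (reading : IsReadingEnum ν e) where

  private
    e-in : ∀ i → InNu ν (e i)
    e-in = proj₁ reading
    e-onto : ∀ b → InNu ν b → ∃ λ i → e i ≡ b
    e-onto = proj₁ (proj₂ reading)
    e-ordered : ∀ i j → i Fin.< j → ReadingBefore (e i) (e j)
    e-ordered = proj₂ (proj₂ reading)

  before⇒index< : ∀ {i j} → ReadingBefore (e i) (e j) → i Fin.< j
  before⇒index< {i} {j} before with FinP.<-cmp i j
  ... | tri< i<j _ _ = i<j
  ... | tri≈ _ refl _ = ⊥-elim (ReadingBefore-asym before before)
  ... | tri> _ _ j<i = ⊥-elim (ReadingBefore-asym before (e-ordered j i j<i))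

  e-injective : ∀ {i j} → e i ≡ e j → i ≡ j
  e-injective {i} {j} eᵢ≡eⱼ with FinP.<-cmp i j
  ... | tri< i<j _ _ = ⊥-elim (ReadingBefore-asym before before)
    where before = subst (ReadingBefore (e i)) (sym eᵢ≡eⱼ) (e-ordered i j i<j)
  ... | tri≈ _ i≡j _ = i≡j
  ... | tri> _ _ j<i = ⊥-elim (ReadingBefore-asym before before)
    where before = subst (ReadingBefore (e j)) eᵢ≡eⱼ (e-ordered j i j<i)

  posRoot-setA⇔ : ∀ i j → posRoot (setA e) i j ≡ true ⇔
    (shp (e i) ≡ shp (e j) × col (e j) ℕ.+ row (e i) ≡ col (e i) ℕ.+ row (e j) × row (e i) ℕ.< row (e j))
  posRoot-setA⇔ i j = mk⇔ forward backward
    where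
    forward : posRoot (setA e) i j ≡ true →
      shp (e i) ≡ shp (e j) × col (e j) ℕ.+ row (e i) ≡ col (e i) ℕ.+ row (e j) × row (e i) ℕ.< row (e j)
    forward h with ∧-true⁻ (does (i Fin.<? j)) h
    ... | i<j , not-adj< with e-ordered i j (dec-true⁻¹ (i Fin.<? j) i<j)
    ...   | inj₁ adj< = ⊥-elim (dec-false⁻¹ (adj (e i) ℤ.<? adj (e j)) (not-true⁻ not-adj<) adj<)
    ...   | inj₂ (adj≡ , row<) = let (shp≡ , diag≡) = to (adj-≡⇔ (e i) (e j)) adj≡ in shp≡ , diag≡ , row<
    backward : shp (e i) ≡ shp (e j) × col (e j) ℕ.+ row (e i) ≡ col (e i) ℕ.+ row (e j) × row (e i) ℕ.< row (e j) →
      posRoot (setA e) i j ≡ true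
    backward (shp≡ , diag≡ , row<) =
      cong₂ _∧_ (dec-true (i Fin.<? j) (before⇒index< (inj₂ (adj≡ , row<))))
                (cong not (dec-false (adj (e i) ℤ.<? adj (e j)) (ℤP.<-irrefl adj≡)))
      where adj≡ = from (adj-≡⇔ (e i) (e j)) (shp≡ , diag≡)

  posRoot-setB⇔ : ∀ i j → posRoot (setB e) i j ≡ true ⇔
    (shp (e i) ≡ shp (e j) × col (e j) ℕ.+ row (e i) ≡ suc (col (e i) ℕ.+ row (e j)) × row (e i) ℕ.≤ row (e j))
  posRoot-setB⇔ i j = mk⇔ forward backward
    where
    forward : posRoot (setB e) i j ≡ true →
      shp (e i) ≡ shp (e j) × col (e j) ℕ.+ row (e i) ≡ suc (col (e i) ℕ.+ row (e j)) × row (e i) ℕ.≤ row (e j)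
    forward h = shp≡ , diag≡ , row≤
      where
      inB = proj₂ (∧-true⁻ (does (i Fin.<? j)) h)
      Rt×notRqt = ∧-true⁻ (inRt e i j) (proj₁ (∧-true⁻ (inRt e i j ∧ not (inRqt e i j)) inB))
      precEq-holds = proj₁ (∧-true⁻ (precEq (e i) (e j)) (proj₂ (∧-true⁻ (inRt e i j ∧ not (inRqt e i j)) inB)))
      adj≡ : adj (e i) + shift k ≡ adj (e j)
      adj≡ = ℤP.≤-antisym (dec-true⁻¹ (adj (e i) + shift k ℤ.≤? adj (e j)) (proj₁ Rt×notRqt))
                          (ℤP.≮⇒≥ (dec-false⁻¹ (adj (e i) + shift k ℤ.<? adj (e j)) (not-true⁻ (proj₂ Rt×notRqt))))
      shp≡ = proj₁ (to (adj-+shift⇔ (e i) (e j)) adj≡)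
      diag≡ = proj₂ (to (adj-+shift⇔ (e i) (e j)) adj≡)
      row≤ = dec-true⁻¹ (row (e i) ℕ.≤? row (e j))
               (proj₂ (∧-true⁻ (does (col (e i) ℕ.≤? col (e j)))
                 (proj₂ (∧-true⁻ (does (shp (e i) Fin.≟ shp (e j))) precEq-holds))))
    backward : shp (e i) ≡ shp (e j) × col (e j) ℕ.+ row (e i) ≡ suc (col (e i) ℕ.+ row (e j)) × row (e i) ℕ.≤ row (e j) →
      posRoot (setB e) i j ≡ true
    backward (shp≡ , diag≡ , row≤) =
      cong₂ _∧_ (dec-true (i Fin.<? j) (before⇒index< (inj₁ adj<)))
        (cong₂ _∧_ (cong₂ _∧_ (dec-true (adj (e i) + shift k ℤ.≤? adj (e j)) (ℤP.≤-reflexive adj≡))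
                              (cong not (dec-false (adj (e i) + shift k ℤ.<? adj (e j)) (ℤP.<-irrefl adj≡))))
                   (cong₂ _∧_ (cong₂ _∧_ (dec-true (shp (e i) Fin.≟ shp (e j)) shp≡)
                                         (cong₂ _∧_ (dec-true (col (e i) ℕ.≤? col (e j)) (ℕP.<⇒≤ col<))
                                                    (dec-true (row (e i) ℕ.≤? row (e j)) row≤)))
                              (cong (λ b → not (b ∧ does (row (e i) ℕ.≟ row (e j))))
                                    (dec-false (col (e i) ℕ.≟ col (e j)) (ℕP.<⇒≢ col<)))))
      where
      adj≡ = from (adj-+shift⇔ (e i) (e j)) (shp≡ , diag≡)
      adj< : adj (e i) ℤ.< adj (e j)
      adj< = subst (adj (e i) ℤ.<_) adj≡
               (subst (ℤ._< adj (e i) + shift k) (ℤP.+-identityʳ (adj (e i)))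
                      (ℤP.+-monoʳ-< (adj (e i)) (ℤ.+<+ (ℕ.s≤s ℕ.z≤n))))
      col< : col (e i) ℕ.< col (e j)
      col< = ℕP.+-cancelʳ-< (row (e j)) (col (e i)) (col (e j))
               (ℕP.≤-trans (ℕP.≤-reflexive (sym diag≡)) (ℕP.+-monoʳ-≤ (col (e j)) row≤))

  count-line : ∀ s r P (rc : ℕ → Bool) (q : Fin l → Bool) →
    (∀ i → q i ≡ true ⇔ (shp (e i) ≡ s × col (e i) ℕ.+ r ≡ P ℕ.+ row (e i) × rc (row (e i)) ≡ true)) →
    count q ≡ count {length (outer (ν s))} (λ y → rc (toℕ y) ∧ lineMeetsRow (ν s) r P (toℕ y))
  count-line s r P rc q q⇔ =
    count-reindex (length (outer (ν s))) (row ∘ e) q (λ y → rc y ∧ lineMeetsRow (ν s) r P y) bounded injective onto into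
    where
    in-shape : ∀ i → q i ≡ true → InSkew (ν s) (col (e i)) (row (e i))
    in-shape i qᵢ = subst (λ z → InSkew (ν z) (col (e i)) (row (e i))) (proj₁ (to (q⇔ i) qᵢ)) (e-in i)
    bounded : ∀ i → q i ≡ true → row (e i) ℕ.< length (outer (ν s))
    bounded i qᵢ = <at⇒<length (outer (ν s)) (row (e i)) (proj₂ (in-shape i qᵢ))
    injective : ∀ i j → q i ≡ true → q j ≡ true → row (e i) ≡ row (e j) → i ≡ j
    injective i j qᵢ qⱼ row≡ with to (q⇔ i) qᵢ | to (q⇔ j) qⱼ
    ... | shpᵢ , lineᵢ , _ | shpⱼ , lineⱼ , _ =
      e-injective (Box-≡ (trans shpᵢ (sym shpⱼ))
                         (ℕP.+-cancelʳ-≡ r (col (e i)) (col (e j)) (trans lineᵢ (trans (cong (P ℕ.+_) row≡) (sym lineⱼ))))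
                         row≡)
    onto : ∀ y → rc y ∧ lineMeetsRow (ν s) r P y ≡ true → ∃ λ i → q i ≡ true × row (e i) ≡ y
    onto y h with ∧-true⁻ (rc y) h
    ... | rcy , meets with to (lineMeetsRow⇔ (ν s) r P y) meets
    ...   | x , on-line , x∈S with e-onto (box s x y) x∈S
    ...     | i , eᵢ≡b = i , from (q⇔ i) ( cong shp eᵢ≡b
                                         , subst (λ b → col b ℕ.+ r ≡ P ℕ.+ row b) (sym eᵢ≡b) on-line
                                         , subst (λ b → rc (row b) ≡ true) (sym eᵢ≡b) rcy)
                       , cong row eᵢ≡b
    into : ∀ i → q i ≡ true → rc (row (e i)) ∧ lineMeetsRow (ν s) r P (row (e i)) ≡ true
    into i qᵢ with to (q⇔ i) qᵢ
    ... | _ , lineᵢ , rcᵢ = cong₂ _∧_ rcᵢ (from (lineMeetsRow⇔ (ν s) r P (row (e i))) (col (e i) , lineᵢ , in-shape i qᵢ))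

  module _ (m : Fin l) where

    private
      a = e m
      N = length (outer (ν (shp a)))

    open RowCount (ν (shp a)) a (e-in m)

    count-onDiagBelow : count (λ i → posRoot (setA e) i m) ≡ count {N} (λ y → onDiagBelow (toℕ y))
    count-onDiagBelow = count-line (shp a) (row a) (col a) (λ y → does (y ℕ.<? row a)) (λ i → posRoot (setA e) i m)
      (λ i → mk⇔ (λ (shp≡ , diag≡ , below) → shp≡ , sym diag≡ , dec-true (row (e i) ℕ.<? row a) below)
                 (λ (shp≡ , diag≡ , below) → shp≡ , sym diag≡ , dec-true⁻¹ (row (e i) ℕ.<? row a) below)
             ⇔-∘ posRoot-setA⇔ i m)

    count-onDiagAbove : count (posRoot (setA e) m) ≡ count {N} (λ y → onDiagAbove (toℕ y))
    count-onDiagAbove = count-line (shp a) (row a) (col a) (λ y → does (row a ℕ.<? y)) (posRoot (setA e) m)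
      (λ j → mk⇔ (λ (shp≡ , diag≡ , above) → sym shp≡ , diag≡ , dec-true (row a ℕ.<? row (e j)) above)
                 (λ (shp≡ , diag≡ , above) → sym shp≡ , diag≡ , dec-true⁻¹ (row a ℕ.<? row (e j)) above)
             ⇔-∘ posRoot-setA⇔ m j)

    count-onNextDiagAbove : count (posRoot (setB e) m) ≡ count {N} (λ y → onNextDiagAbove (toℕ y))
    count-onNextDiagAbove = count-line (shp a) (row a) (suc (col a)) (λ y → does (row a ℕ.≤? y)) (posRoot (setB e) m)
      (λ j → mk⇔ (λ (shp≡ , diag≡ , above) → sym shp≡ , diag≡ , dec-true (row a ℕ.≤? row (e j)) above)
                 (λ (shp≡ , diag≡ , above) → sym shp≡ , diag≡ , dec-true⁻¹ (row a ℕ.≤? row (e j)) above)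
             ⇔-∘ posRoot-setB⇔ m j)

    count-onPrevDiagBelow : count (λ i → posRoot (setB e) i m) ≡ count {N} (λ y → onPrevDiagBelow (toℕ y))
    count-onPrevDiagBelow = count-line (shp a) (suc (row a)) (col a) (λ y → does (y ℕ.≤? row a)) (λ i → posRoot (setB e) i m)
      (λ i → mk⇔ (λ (shp≡ , diag≡ , below) → shp≡ , trans (ℕP.+-suc (col (e i)) (row a)) (sym diag≡)
                                             , dec-true (row (e i) ℕ.≤? row a) below)
                 (λ (shp≡ , line≡ , below) → shp≡ , sym (trans (sym (ℕP.+-suc (col (e i)) (row a))) line≡)
                                             , dec-true⁻¹ (row (e i) ℕ.≤? row a) below)
             ⇔-∘ posRoot-setB⇔ i m)

    lam≡sumRoots : lam ν e m ≡ - sumRoots (setA e) m + sumRoots (setB e) m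
    lam≡sumRoots = sym (begin
      - sumRoots (setA e) m + sumRoots (setB e) m
        ≡⟨ cong₂ (λ u v → - u + v) (sumRoots-count (setA e) m) (sumRoots-count (setB e) m) ⟩
      - (count (posRoot (setA e) m) - count (λ i → posRoot (setA e) i m))
        + (count (posRoot (setB e) m) - count (λ i → posRoot (setB e) i m))
        ≡⟨ cong₂ (λ u v → - u + v) (cong₂ _-_ count-onDiagAbove count-onDiagBelow)
                                   (cong₂ _-_ count-onNextDiagAbove count-onPrevDiagBelow) ⟩
      - (rows onDiagAbove - rows onDiagBelow) + (rows onNextDiagAbove - rows onPrevDiagBelow)
        ≡⟨ sym (finSum-combination {N} (χ ∘ onDiagAbove ∘ toℕ) (χ ∘ onDiagBelow ∘ toℕ)
                                   (χ ∘ onNextDiagAbove ∘ toℕ) (χ ∘ onPrevDiagBelow ∘ toℕ)) ⟩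
      finSum {N} (λ y → - (χ (onDiagAbove (toℕ y)) - χ (onDiagBelow (toℕ y)))
                        + (χ (onNextDiagAbove (toℕ y)) - χ (onPrevDiagBelow (toℕ y))))
        ≡⟨ finSum-cong {N} (λ y → row-identity (toℕ y)) ⟩
      finSum {N} (λ y → χ (firstOnDiag (toℕ y)) - χ (lastOnDiag (toℕ y)))
        ≡⟨ finSum-distrib-- {N} (χ ∘ firstOnDiag ∘ toℕ) (χ ∘ lastOnDiag ∘ toℕ) ⟩
      rows firstOnDiag - rows lastOnDiag
        ≡⟨ cong₂ _-_ count-firstOnDiag count-lastOnDiag ⟩
      lam ν e m
        ∎)
      where
      open ≡-Reasoning
      rows : (ℕ → Bool) → ℤ
      rows F = count {N} (λ y → F (toℕ y))

proposition7p6 : ∀ {k : ℕ} (ν : Fin k → Skew) (l : ℕ) (e : Fin l → Box k)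
    → IsReadingEnum ν e
    → (∀ m → lam ν e m ≡ χ (diagHasNoLast ν (e m)) - χ (diagHasNoFirst ν (e m)))
      × (∀ m → lam ν e m ≡ - sumRoots (setA e) m + sumRoots (setB e) m)
proposition7p6 ν l e reading =
  (λ m → χ-sub-not (diagHasFirst ν (e m)) (diagHasLast ν (e m))) ,
  ReadingEnum.lam≡sumRoots ν e reading
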